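{- Let $L\ge2$, $n\ge2$ be integers. For any integer $0\le t\le n-2$, $\xi_{L^{t+1}}(K_L^n)-\xi_{L^t}(K_L^n)\ge0$.
   Context: $K_L^n$ is the graph on strings $x_n\cdots x_1$ over $\{0,\dots,L-1\}$, adjacent iff they differ in exactly one coordinate. For an integer $0\le m\le L^n$ with base-$L$ expansion $m=\sum_{i=0}^{s}a_iL^{b_i}$ ($a_i\in\{1,\dots,L-1\}$, $b_0>\dots>b_s\ge0$) let $ex_m(K_L^n)=\sum_{i=0}^{s}[(L-1)a_ib_iL^{b_i}+(a_i-1)a_iL^{b_i}]+2\sum_{i=0}^{s-1}\sum_{k=i+1}^{s}a_ia_kL^{b_k}$ ($ex_0=0$), and $\xi_m(K_L^n)=(L-1)nm-ex_m(K_L^n)$. -}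

module Defs where

open import Data.Nat using (ℕ; zero; suc; _+_; _*_; _∸_; _^_; NonZero)
open import Data.Nat.DivMod using (_/_; _%_)
open import Data.Nat.Properties using (_≟_; m^n≢0)
open import Data.List using (List; []; _∷_; downFrom)
open import Data.Product using (_×_; _,_)
open import Data.Integer using (ℤ; +_; _-_)
open import Relation.Nullary using (yes; no)

digit : (L : ℕ) → .{{_ : NonZero L}} → ℕ → ℕ → ℕ
digit L m j = _/_ m (L ^ j) {{m^n≢0 L j}} % L

-- base-L expansion of m as the list of pairs (a_i , b_i) with a_i ≠ 0,
-- b_0 > b_1 > ... > b_s ≥ 0  (positions above m always carry digit 0,
-- since L ^ j > j for L ≥ 2)
expansionFrom : (L : ℕ) → .{{_ : NonZero L}} → ℕ → List ℕ → List (ℕ × ℕ)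
expansionFrom L m [] = []
expansionFrom L m (j ∷ js) with digit L m j ≟ 0
... | yes _ = expansionFrom L m js
... | no _ = (digit L m j , j) ∷ expansionFrom L m js

expansion : (L : ℕ) → .{{_ : NonZero L}} → ℕ → List (ℕ × ℕ)
expansion L m = expansionFrom L m (downFrom (suc m))

crossSum : ℕ → ℕ → List (ℕ × ℕ) → ℕ
crossSum L a [] = 0
crossSum L a ((a' , b') ∷ rest) = a * a' * L ^ b' + crossSum L a rest

exList : ℕ → List (ℕ × ℕ) → ℕ
exList L [] = 0
exList L ((a , b) ∷ rest) =
  ((L ∸ 1) * a * b * L ^ b + (a ∸ 1) * a * L ^ b)
  + 2 * crossSum L a rest
  + exList L rest

-- ex_m(K_L^n) (independent of n)
ex : (L : ℕ) → .{{_ : NonZero L}} → ℕ → ℕ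
ex L m = exList L (expansion L m)

ξ : (L : ℕ) → .{{_ : NonZero L}} → (n m : ℕ) → ℤ
ξ L n m = + ((L ∸ 1) * n * m) - + ex L m

{-# OPTIONS --safe #-}
-- The base-L expansion of a power L ^ b is the single digit 1 at position b,
-- so ex (L ^ b) = (L - 1) b L ^ b and ξ (L ^ b) = (L - 1) (n - b) L ^ b.
-- The claim becomes (L - 1) (n - t) L ^ t ≤ (L - 1) (n - t - 1) L ^ (t + 1),
-- which holds because n - t - 1 ≥ 1 and L ≥ 2 give n - t ≤ (n - t - 1) L.
module Submission where

open import Defs
open import Data.Nat using (ℕ; _≤_; _^_; NonZero; zero; suc; _+_; _*_; _∸_; _<_; _≟_; z≤n; s≤s; s≤s⁻¹)
open import Data.Integer using (_-_; +_; _⊖_; +≤+) renaming (_≤_ to _≤ℤ_)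
open import Data.Nat.Properties
open import Data.Nat.DivMod using (_%_; m*n/n≡m; m*n%n≡0; m<n⇒m/n≡0; m<n⇒m%n≡m)
open import Data.Nat.Tactic.RingSolver using (solve; solve-∀)
import Data.Integer.Properties as ℤₚ
open import Data.Integer.Properties using ([+m]-[+n]≡m⊖n; ⊖-≥; i≤j⇒0≤j-i)
open import Data.List using ([]; _∷_; downFrom)
open import Data.Product using (_,_)
open import Data.Empty using (⊥-elim)
open import Relation.Binary.Definitions using (tri<; tri≈; tri>)
open import Relation.Nullary using (¬_; yes; no; contradiction)
open import Relation.Binary.PropositionalEquality

[+m+n]-[+m]≡+n : ∀ m n → + (m + n) - + m ≡ + n
[+m+n]-[+m]≡+n m n = begin
  + (m + n) - + m ≡⟨ [+m]-[+n]≡m⊖n (m + n) m ⟩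
  (m + n) ⊖ m     ≡⟨ ⊖-≥ (m≤m+n m n) ⟩
  + (m + n ∸ m)   ≡⟨ cong +_ (m+n∸m≡n m n) ⟩
  + n             ∎
  where open ≡-Reasoning

2+n≤[1+n]*m : ∀ n {m} → 2 ≤ m → 2 + n ≤ (1 + n) * m
2+n≤[1+n]*m n {m@(suc _)} 2≤m = +-mono-≤ 2≤m (m≤m*n n m)

k*[2+n]*p≤k*[1+n]*[m*p] : ∀ k n p {m} → 2 ≤ m → k * (2 + n) * p ≤ k * (1 + n) * (m * p)
k*[2+n]*p≤k*[1+n]*[m*p] k n p {m} 2≤m = begin
  k * (2 + n) * p       ≤⟨ *-monoˡ-≤ p (*-monoʳ-≤ k (2+n≤[1+n]*m n 2≤m)) ⟩
  k * ((1 + n) * m) * p ≡⟨ solve (k ∷ n ∷ p ∷ m ∷ []) ⟩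
  k * (1 + n) * (m * p) ∎
  where open ≤-Reasoning

module _ (L : ℕ) .{{_ : NonZero L}} where
  open ≡-Reasoning

  digit-*-^ : ∀ m j → digit L (m * L ^ j) j ≡ m % L
  digit-*-^ m j = cong (_% L) (m*n/n≡m m (L ^ j) {{m^n≢0 L j}})

  expansionFrom-digit≡0 : ∀ {m j} js → digit L m j ≡ 0 →
                          expansionFrom L m (j ∷ js) ≡ expansionFrom L m js
  expansionFrom-digit≡0 {m} {j} js d≡0 with digit L m j ≟ 0
  ... | yes _  = refl
  ... | no d≢0 = contradiction d≡0 d≢0

  expansionFrom-digit≢0 : ∀ {m j} js → ¬ digit L m j ≡ 0 →
                          expansionFrom L m (j ∷ js) ≡ (digit L m j , j) ∷ expansionFrom L m js
  expansionFrom-digit≢0 {m} {j} js d≢0 with digit L m j ≟ 0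
  ... | yes d≡0 = contradiction d≡0 d≢0
  ... | no _    = refl

  module _ (1<L : 1 < L) where

    n<L^n : ∀ n → n < L ^ n
    n<L^n zero    = s≤s z≤n
    n<L^n (suc n) = ≤-<-trans (n<L^n n) (^-monoʳ-< L 1<L (n<1+n n))

    digit-^-below : ∀ {b j} → j < b → digit L (L ^ b) j ≡ 0
    digit-^-below {b} {j} j<b with d , refl ← m≤n⇒∃[o]m+o≡n j<b = begin
      digit L (L ^ (suc j + d)) j   ≡⟨ cong (λ x → digit L x j) L^[1+j+d]≡L^[1+d]*L^j ⟩
      digit L (L ^ suc d * L ^ j) j ≡⟨ digit-*-^ (L ^ suc d) j ⟩
      (L * L ^ d) % L               ≡⟨ cong (_% L) (*-comm L (L ^ d)) ⟩
      (L ^ d * L) % L               ≡⟨ m*n%n≡0 (L ^ d) L ⟩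
      0                             ∎
      where
      L^[1+j+d]≡L^[1+d]*L^j : L ^ (suc j + d) ≡ L ^ suc d * L ^ j
      L^[1+j+d]≡L^[1+d]*L^j = begin
        L ^ (suc j + d)     ≡⟨ cong (L ^_) (trans (+-comm (suc j) d) (+-suc d j)) ⟩
        L ^ (suc d + j)     ≡⟨ ^-distribˡ-+-* L (suc d) j ⟩
        L ^ suc d * L ^ j   ∎

    digit-^-above : ∀ {b j} → b < j → digit L (L ^ b) j ≡ 0
    digit-^-above {b} {j} b<j =
      trans (cong (_% L) (m<n⇒m/n≡0 {{m^n≢0 L j}} (^-monoʳ-< L 1<L b<j))) (m*n%n≡0 0 L)

    digit-^-at : ∀ b → digit L (L ^ b) b ≡ 1
    digit-^-at b = begin
      digit L (L ^ b) b     ≡⟨ cong (λ x → digit L x b) (sym (*-identityˡ (L ^ b))) ⟩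
      digit L (1 * L ^ b) b ≡⟨ digit-*-^ 1 b ⟩
      1 % L                 ≡⟨ m<n⇒m%n≡m 1<L ⟩
      1                     ∎

    expansionFrom-^-below : ∀ b k → k ≤ b → expansionFrom L (L ^ b) (downFrom k) ≡ []
    expansionFrom-^-below b zero    _   = refl
    expansionFrom-^-below b (suc k) k<b =
      trans (expansionFrom-digit≡0 (downFrom k) (digit-^-below k<b))
            (expansionFrom-^-below b k (<⇒≤ k<b))

    expansionFrom-^-above : ∀ b k → b < k → expansionFrom L (L ^ b) (downFrom k) ≡ (1 , b) ∷ []
    expansionFrom-^-above b (suc k) b<1+k with <-cmp b k
    ... | tri< b<k _ _ =
      trans (expansionFrom-digit≡0 (downFrom k) (digit-^-above b<k))
            (expansionFrom-^-above b k b<k)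
    ... | tri≈ _ refl _ = begin
      expansionFrom L (L ^ b) (b ∷ downFrom b)
        ≡⟨ expansionFrom-digit≢0 (downFrom b) (λ d≡0 → 1+n≢0 (trans (sym (digit-^-at b)) d≡0)) ⟩
      (digit L (L ^ b) b , b) ∷ expansionFrom L (L ^ b) (downFrom b)
        ≡⟨ cong₂ (λ d rest → (d , b) ∷ rest) (digit-^-at b) (expansionFrom-^-below b b ≤-refl) ⟩
      (1 , b) ∷ [] ∎
    ... | tri> _ _ k<b = ⊥-elim (<⇒≱ k<b (s≤s⁻¹ b<1+k))

    expansion-^ : ∀ b → expansion L (L ^ b) ≡ (1 , b) ∷ []
    expansion-^ b = expansionFrom-^-above b (suc (L ^ b)) (s≤s (<⇒≤ (n<L^n b)))

    ex-^ : ∀ b → ex L (L ^ b) ≡ (L ∸ 1) * b * L ^ b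
    ex-^ b rewrite expansion-^ b = exList-single (L ∸ 1) b (L ^ b)
      where
      exList-single : ∀ k b P → k * 1 * b * P + 0 * 1 * P + 2 * 0 + 0 ≡ k * b * P
      exList-single = solve-∀

    ξ-^ : ∀ {n} b u → b + u ≡ n → ξ L n (L ^ b) ≡ + ((L ∸ 1) * u * L ^ b)
    ξ-^ b u refl = begin
      + ((L ∸ 1) * (b + u) * L ^ b) - + ex L (L ^ b)
        ≡⟨ cong₂ (λ x y → + x - + y) (distrib (L ∸ 1) b u (L ^ b)) (ex-^ b) ⟩
      + ((L ∸ 1) * b * L ^ b + (L ∸ 1) * u * L ^ b) - + ((L ∸ 1) * b * L ^ b)
        ≡⟨ [+m+n]-[+m]≡+n ((L ∸ 1) * b * L ^ b) _ ⟩
      + ((L ∸ 1) * u * L ^ b) ∎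
      where
      distrib : ∀ k b u P → k * (b + u) * P ≡ k * b * P + k * u * P
      distrib = solve-∀

mainTheorem5 : (L n : ℕ) → .{{_ : NonZero L}} → 2 ≤ L → 2 ≤ n →
    (t : ℕ) → t Data.Nat.+ 2 ≤ n →
    + 0 ≤ℤ (ξ L n (L ^ (Data.Nat.suc t)) - ξ L n (L ^ t))
mainTheorem5 L n 1<L _ t t+2≤n with o , refl ← m≤n⇒∃[o]m+o≡n t+2≤n = i≤j⇒0≤j-i (begin
  ξ L (t + 2 + o) (L ^ t)                ≡⟨ ξ-^ L 1<L t (2 + o) (sym (+-assoc t 2 o)) ⟩
  + ((L ∸ 1) * (2 + o) * L ^ t)          ≤⟨ +≤+ (k*[2+n]*p≤k*[1+n]*[m*p] (L ∸ 1) o (L ^ t) 1<L) ⟩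
  + ((L ∸ 1) * (1 + o) * L ^ suc t)      ≡⟨ ξ-^ L 1<L (suc t) (suc o) (1+t+[1+o]≡t+2+o t o) ⟨
  ξ L (t + 2 + o) (L ^ suc t)            ∎)
  where
  open ℤₚ.≤-Reasoning
  1+t+[1+o]≡t+2+o : ∀ t o → suc t + suc o ≡ t + 2 + o
  1+t+[1+o]≡t+2+o = solve-∀
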